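{- For every positive integer $n$, each of the following statistics on $S_n$ is homomesic with respect to the complement map $\mathcal{C}$, while, for each of them, there is some $n$ for which it is not homomesic on $S_n$ with respect to the reverse map $\mathcal{R}$: (1) the number of inversions of the second entry, $\#\{j>2:\sigma_j<\sigma_2\}$; (2) the number of inversions of the third entry, $\#\{j>3:\sigma_j<\sigma_3\}$; (3) the major index; (4) the number of odd descents; (5) the number of even descents; (6) the rank; (7) the first entry $\sigma_1$; (8) the staircase size; (9) the Babson–Steingrímsson statistic $\mathrm{stat}$; (10) the last entry $\sigma_n$; (11) the number of steps on the non-negative side of the walk associated with $\sigma$; (12) $\mathrm{maj}(\sigma)-\mathrm{inv}(\sigma)$; (13) $\mathrm{inv}(\sigma)+\mathrm{maj}(\sigma)$.
   Context: Homomesy: given a finite set $S$, a bijection $\mathcal{X}:S\to S$ and $f:S\to\mathbb{Z}$, $f$ is homomesic if there is a constant $c$ such that for every orbit $\mathcal{O}$ of $\mathcal{X}$, $\frac{1}{|\mathcal{O}|}\sum_{x\in\mathcal{O}}f(x)=c$. For $\sigma\in S_n$ in one-line notation: $\mathcal{R}(\sigma)_i=\sigma_{n+1-i}$, $\mathcal{C}(\sigma)_i=n+1-\sigma_i$. $\mathrm{inv}(\sigma)$ is the number of pairs $i<j$ with $\sigma_i>\sigma_j$. A descent is $i\in[n-1]$ with $\sigma_i>\sigma_{i+1}$, otherwise an ascent; $\mathrm{maj}(\sigma)$ is the sum of the descents; odd (even) descents are descents $i$ with $i$ odd (even). The rank of $\sigma$ is its position ($1$ to $n!$) in lexicographic order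 on $S_n$. The Lehmer code is $L(\sigma)_i=\#\{j>i:\sigma_j<\sigma_i\}$; the staircase size is the largest $k$ for which there exist indices $i_k<i_{k-1}<\dots<i_1$ with $L(\sigma)_{i_j}\ge j$ for all $j$. An occurrence of the vincular pattern $ab\text{ - }c$ is a triple of positions $i<i+1<k$ with $\sigma_i\sigma_{i+1}\sigma_k$ in the same relative order as $abc$; $\mathrm{stat}(\sigma)$ is the total number of occurrences of $13\text{ - }2$, $21\text{ - }3$, $32\text{ - }1$ plus the number of descents. The walk associated with $\sigma$ starts at height $0$ and, for $i=1,\dots,n-1$, takes an up step if $i$ is an ascent and a down step if $i$ is a descent; the statistic counts the steps that begin and end at non-negative height. -}

module Defs where

open import Data.Nat as ℕ using (ℕ; zero; suc; _+_; _*_; _∸_; _≤_; _<_; _<ᵇ_; _≤ᵇ_; _≡ᵇ_; NonZero)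
open import Data.Integer as ℤ using (ℤ; +_)
open import Data.Rational using (ℚ; _/_)
open import Data.Bool using (Bool; true; false; if_then_else_; _∧_; _∨_; not)
open import Data.List using (List; []; _∷_; length; map; filter; reverse; upTo; drop; concatMap)
open import Data.Nat.ListAction using (sum)
open import Data.List.Relation.Binary.Permutation.Propositional using (_↭_)
open import Relation.Binary.PropositionalEquality using (_≡_; _≢_)
open import Relation.Nullary.Decidable using (⌊_⌋)
open import Data.Product using (Σ; _×_)

iter : {A : Set} → (A → A) → ℕ → A → A
iter X zero    x = x
iter X (suc k) x = X (iter X k x)

IsOrbitLength : {A : Set} → (A → A) → A → ℕ → Set
IsOrbitLength X x k = (iter X k x ≡ x) × (∀ j → 0 < j → j < k → iter X j x ≢ x)

orbitSum : {A : Set} → (A → ℤ) → (A → A) → A → ℕ → ℤ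
orbitSum f X x zero    = + 0
orbitSum f X x (suc k) = orbitSum f X x k ℤ.+ f (iter X k x)

Homomesic : {A : Set} → (S : A → Set) → (X : A → A) → (f : A → ℤ) → Set
Homomesic S X f =
  Σ ℚ λ c → ∀ x → S x → ∀ k → .{{_ : NonZero k}} → IsOrbitLength X x k →
    orbitSum f X x k / k ≡ c

oneTo : ℕ → List ℕ
oneTo n = map suc (upTo n)

IsPerm : ℕ → List ℕ → Set
IsPerm n σ = σ ↭ oneTo n

revMap : List ℕ → List ℕ
revMap σ = reverse σ

compMap : ℕ → List ℕ → List ℕ
compMap n σ = map (λ a → suc n ∸ a) σ

countLess : ℕ → List ℕ → ℕ
countLess a xs = length (filter (λ b → b ℕ.<? a) xs)

-- #{ j > i : σ_j < σ_i }  (i is 1-based; 0 if σ has no i-th entry)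
invOfEntry : ℕ → List ℕ → ℕ
invOfEntry i σ with drop (i ∸ 1) σ
... | []       = 0
... | a ∷ rest = countLess a rest

inv : List ℕ → ℕ
inv []       = 0
inv (a ∷ xs) = countLess a xs + inv xs

-- list of descents i (1-based positions), starting position given
descentsFrom : ℕ → List ℕ → List ℕ
descentsFrom i []           = []
descentsFrom i (a ∷ [])     = []
descentsFrom i (a ∷ b ∷ xs) =
  if b <ᵇ a then i ∷ descentsFrom (suc i) (b ∷ xs) else descentsFrom (suc i) (b ∷ xs)

descents : List ℕ → List ℕ
descents σ = descentsFrom 1 σ

maj : List ℕ → ℕ
maj σ = sum (descents σ)

isOdd : ℕ → Bool
isOdd zero    = false
isOdd (suc n) = not (isOdd n)

oddDescents : List ℕ → ℕ
oddDescents σ = length (filter (λ i → Relation.Nullary.Decidable.Core.T? (isOdd i)) (descents σ))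
  where import Relation.Nullary.Decidable.Core

evenDescents : List ℕ → ℕ
evenDescents σ = length (filter (λ i → Relation.Nullary.Decidable.Core.T? (not (isOdd i))) (descents σ))
  where import Relation.Nullary.Decidable.Core

firstEntry : List ℕ → ℕ
firstEntry []      = 0
firstEntry (a ∷ _) = a

lastEntry : List ℕ → ℕ
lastEntry []           = 0
lastEntry (a ∷ [])     = a
lastEntry (a ∷ b ∷ xs) = lastEntry (b ∷ xs)

words : ℕ → ℕ → List (List ℕ)
words n zero    = [] ∷ []
words n (suc k) = concatMap (λ a → map (a ∷_) (words n k)) (oneTo n)

memberB : ℕ → List ℕ → Bool
memberB a []       = false
memberB a (b ∷ xs) = (a ≡ᵇ b) ∨ memberB a xs

allB : {A : Set} → (A → Bool) → List A → Bool
allB p []       = true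
allB p (x ∷ xs) = p x ∧ allB p xs

-- a word of length n over [1..n] is a permutation iff every i ∈ [1..n] occurs
isPermWordB : ℕ → List ℕ → Bool
isPermWordB n τ = allB (λ i → memberB i τ) (oneTo n)

permsList : ℕ → List (List ℕ)
permsList n = filter (λ τ → Relation.Nullary.Decidable.Core.T? (isPermWordB n τ)) (words n n)
  where import Relation.Nullary.Decidable.Core

lexLtB : List ℕ → List ℕ → Bool
lexLtB []       []       = false
lexLtB []       (_ ∷ _)  = true
lexLtB (_ ∷ _)  []       = false
lexLtB (a ∷ xs) (b ∷ ys) = (a <ᵇ b) ∨ ((a ≡ᵇ b) ∧ lexLtB xs ys)

rank : List ℕ → ℕ
rank σ = suc (length (filter (λ τ → Relation.Nullary.Decidable.Core.T? (lexLtB τ σ))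
                             (permsList (length σ))))
  where import Relation.Nullary.Decidable.Core

lehmer : List ℕ → List ℕ
lehmer []       = []
lehmer (a ∷ xs) = countLess a xs ∷ lehmer xs

-- canPick j k ys : with ys the Lehmer code read from right to left,
-- one can choose positions p_j, p_{j+1}, ..., p_k, successively further
-- to the left (i.e. strictly decreasing indices i_j > i_{j+1} > ... > i_k
-- in σ), with L_{i_m} ≥ m for every m.  (Empty choice when j > k.)
canPick : ℕ → ℕ → List ℕ → Bool
canPick j k ys with k <ᵇ j
canPick j k ys       | true  = true
canPick j k []       | false = false
canPick j k (y ∷ ys) | false = ((j ≤ᵇ y) ∧ canPick (suc j) k ys) ∨ canPick j k ys

hasStaircase : List ℕ → ℕ → Bool
hasStaircase σ k = canPick 1 k (reverse (lehmer σ))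

maxStair : List ℕ → ℕ → ℕ
maxStair σ zero    = 0
maxStair σ (suc m) = if hasStaircase σ (suc m) then suc m else maxStair σ m

-- staircase size (a staircase has size at most length σ)
staircase : List ℕ → ℕ
staircase σ = maxStair σ (length σ)

patB : ℕ → ℕ → ℕ → Bool
patB a b c = ((a <ᵇ c) ∧ (c <ᵇ b))
           ∨ ((b <ᵇ a) ∧ (a <ᵇ c))
           ∨ ((c <ᵇ b) ∧ (b <ᵇ a))

vincOcc : List ℕ → ℕ
vincOcc []           = 0
vincOcc (a ∷ [])     = 0
vincOcc (a ∷ b ∷ xs) =
  length (filter (λ c → Relation.Nullary.Decidable.Core.T? (patB a b c)) xs) + vincOcc (b ∷ xs)
  where import Relation.Nullary.Decidable.Core

bsStat : List ℕ → ℕ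
bsStat σ = vincOcc σ + length (descents σ)

nonNeg : ℤ → Bool
nonNeg (+ _)       = true
nonNeg ℤ.-[1+ _ ]  = false

walkCount : ℤ → List ℕ → ℕ
walkCount h []           = 0
walkCount h (a ∷ [])     = 0
walkCount h (a ∷ b ∷ xs) =
  let h′ = if b <ᵇ a then h ℤ.- + 1 else h ℤ.+ + 1
  in (if nonNeg h ∧ nonNeg h′ then 1 else 0) + walkCount h′ (b ∷ xs)

nonNegSteps : List ℕ → ℕ
nonNegSteps σ = walkCount (+ 0) σ

Claim : (List ℕ → ℤ) → Set
Claim f = (∀ n → 1 ≤ n → Homomesic (IsPerm n) (compMap n) f)
        × (Σ ℕ λ n → 1 ≤ n × ¬ Homomesic (IsPerm n) revMap f)
  where open import Relation.Nullary using (¬_)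

-- Complementation C is an involution of S_n, so its orbits have one or two elements and a statistic f is
-- C-homomesic as soon as f σ + f (C σ) depends only on n. Complementation reverses every comparison between
-- two entries, and this yields such a sum for all thirteen statistics: the descents of σ and of C σ partition
-- [1, n-1]; the Lehmer codes of σ and C σ add up entrywise to (n-1, ..., 1, 0), and since a staircase of
-- maximal size can be picked greedily from the right, the two staircase sizes add up to n-1; the walk of C σ
-- is the mirror image of that of σ, and of a step and its mirror exactly one stays at non-negative height; at
-- positions i, i+1, k exactly one of σ and C σ has an occurrence of 13-2, 21-3 or 32-1; and C reverses the
-- lexicographic order of S_n. For the reverse map, two orbits {σ, reverse σ} with different averages are
-- exhibited in S_3, S_4 or S_5.

module Submission where

open import Defs
open import Data.Bool using (Bool; true; false; T; not; if_then_else_; _∧_; _∨_)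
open import Data.Bool.Properties using (T-≡; ∧-zeroʳ; ∧-identityʳ)
open import Data.Empty using (⊥-elim)
open import Data.Integer as ℤ using (ℤ; +_; -[1+_])
import Data.Integer.Properties as ℤ
open import Data.Integer.Tactic.RingSolver using (solve-∀)
open import Data.List using (List; []; _∷_; _++_; _∷ʳ_; concatMap; length; map; filter; reverse; drop)
import Data.List.Properties as List
open import Data.List.Membership.Propositional using (_∈_)
open import Data.List.Membership.Propositional.Properties using (∈-map⁻; ∈-upTo⁻)
open import Data.List.Relation.Binary.Permutation.Propositional
  using (_↭_; prep; swap; ↭-refl; ↭-sym; ↭-trans; ↭-reflexive; ↭⇒↭ₛ)
import Data.List.Relation.Binary.Permutation.Propositional.Properties as ↭
open import Data.List.Relation.Unary.All as All using (All; []; _∷_)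
import Data.List.Relation.Unary.All.Properties as All
open import Data.List.Relation.Unary.AllPairs using ([]; _∷_)
open import Data.List.Relation.Unary.Any using (here; there)
open import Data.List.Relation.Unary.Unique.Propositional using (Unique)
import Data.List.Relation.Unary.Unique.Propositional.Properties as Unique
open import Data.Nat as ℕ using (ℕ; zero; suc; _+_; _∸_; _≤_; _<_; z≤n; s≤s; NonZero; _<ᵇ_; _≤ᵇ_; _≡ᵇ_)
import Data.Nat.Properties as ℕ
open import Algebra.Properties.CommutativeSemigroup ℕ.+-commutativeSemigroup using (interchange)
open import Data.Nat.Combinatorics using (_C_; nC1≡n; nCk+nC[k+1]≡[n+1]C[k+1])
open import Data.Nat.ListAction using (sum)
open import Data.Nat.ListAction.Properties using (sum-++; sum-↭)
open import Data.Product using (Σ; _×_; _,_; proj₁; proj₂)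
open import Data.Rational as ℚ using (ℚ; _/_)
import Data.Rational.Properties as ℚ
import Data.Rational.Unnormalised as ℚᵘ
open import Function using (_∘_; Equivalence)
open import Relation.Binary.Definitions using (tri<; tri≈; tri>)
open import Relation.Binary.PropositionalEquality
open import Data.List.Relation.Binary.Permutation.Setoid.Properties (setoid ℕ) using (Unique-resp-↭)
open import Relation.Nullary using (¬_; T?; yes; no)
open import Relation.Nullary.Reflects using (Reflects; ofʸ; ofⁿ; det; fromEquivalence)
open import Relation.Unary using (Decidable)


-- Homomesy of involutions

x/1≡[x+x]/2 : ∀ x → x / 1 ≡ (x ℤ.+ x) / 2
x/1≡[x+x]/2 x = ℚ.fromℚᵘ-cong {ℚᵘ.mkℚᵘ x 0} {ℚᵘ.mkℚᵘ (x ℤ.+ x) 1} (ℚᵘ.*≡* (cross x))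
  where
  cross : ∀ x → x ℤ.* + 2 ≡ (x ℤ.+ x) ℤ.* + 1
  cross = solve-∀

involution-homomesic : ∀ {A : Set} {S : A → Set} {X : A → A} (f : A → ℤ) (K : ℤ) →
  (∀ {x} → S x → X (X x) ≡ x) → (∀ {x} → S x → f x ℤ.+ f (X x) ≡ K) →
  Homomesic S X f
involution-homomesic {S = S} {X} f K involutive sum≡K = K / 2 , average
  where
  average : ∀ x → S x → ∀ k → .{{_ : NonZero k}} → IsOrbitLength X x k →
            orbitSum f X x k / k ≡ K / 2
  average x x∈S 1 (fixed , _) = begin
    (+ 0 ℤ.+ f x) / 1          ≡⟨ cong (_/ 1) (ℤ.+-identityˡ (f x)) ⟩
    f x / 1                    ≡⟨ x/1≡[x+x]/2 (f x) ⟩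
    (f x ℤ.+ f x) / 2          ≡⟨ cong (λ y → (f x ℤ.+ f y) / 2) (sym fixed) ⟩
    (f x ℤ.+ f (X x)) / 2      ≡⟨ cong (_/ 2) (sum≡K x∈S) ⟩
    K / 2                      ∎
    where open ≡-Reasoning
  average x x∈S 2 _ = cong (_/ 2) (trans (cong (ℤ._+ f (X x)) (ℤ.+-identityˡ (f x))) (sum≡K x∈S))
  average x x∈S (suc (suc (suc k))) (_ , minimal) =
    ⊥-elim (minimal 2 (s≤s z≤n) (s≤s (s≤s (s≤s z≤n))) (involutive x∈S))

two-orbits-not-homomesic : ∀ {A : Set} {S : A → Set} {X : A → A} (f : A → ℤ) {x y} →
  S x → S y → IsOrbitLength X x 2 → IsOrbitLength X y 2 →
  orbitSum f X x 2 / 2 ≢ orbitSum f X y 2 / 2 → ¬ Homomesic S X f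
two-orbits-not-homomesic f x∈S y∈S x-orbit y-orbit averages≢ (c , homomesic) =
  averages≢ (trans (homomesic _ x∈S 2 x-orbit) (sym (homomesic _ y∈S 2 y-orbit)))

reverse-orbit : ∀ σ → reverse σ ≢ σ → IsOrbitLength revMap σ 2
reverse-orbit σ reverse≢ = List.reverse-involutive σ , minimal
  where
  minimal : ∀ j → 0 < j → j < 2 → iter revMap j σ ≢ σ
  minimal 1 _ _ = reverse≢
  minimal (suc (suc j)) _ (s≤s (s≤s ()))

Distinct≤ : ℕ → List ℕ → Set
Distinct≤ N σ = All (_≤ N) σ × Unique σ

∈-oneTo⇒≤ : ∀ n {a} → a ∈ oneTo n → a ≤ n
∈-oneTo⇒≤ n a∈ with ∈-map⁻ suc a∈
... | i , i∈ , refl = ∈-upTo⁻ i∈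

perm-entries≤ : ∀ {n σ} → IsPerm n σ → All (_≤ n) σ
perm-entries≤ {n} σ↭ = All.tabulate (∈-oneTo⇒≤ n ∘ ↭.∈-resp-↭ σ↭)

oneTo-unique : ∀ n → Unique (oneTo n)
oneTo-unique n = Unique.map⁺ ℕ.suc-injective (Unique.upTo⁺ n)

perm-distinct≤ : ∀ {n σ} → IsPerm n σ → Distinct≤ (suc n) σ
perm-distinct≤ {n} σ↭ =
  All.map ℕ.m≤n⇒m≤1+n (perm-entries≤ σ↭) , Unique-resp-↭ (↭⇒↭ₛ (↭-sym σ↭)) (oneTo-unique n)

perm-length : ∀ {n σ} → IsPerm n σ → length σ ≡ n
perm-length {n} σ↭ = trans (↭.↭-length σ↭) (trans (List.length-map suc (upTo n)) (List.length-upTo n))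
  where open Data.List using (upTo)

complement-involutive : ∀ {N σ} → All (_≤ N) σ → map (N ∸_) (map (N ∸_) σ) ≡ σ
complement-involutive []         = refl
complement-involutive (a≤ ∷ σ≤) = cong₂ _∷_ (ℕ.m∸[m∸n]≡n a≤) (complement-involutive σ≤)

compMap-involutive : ∀ {n σ} → IsPerm n σ → compMap n (compMap n σ) ≡ σ
compMap-involutive σ↭ = complement-involutive (All.map ℕ.m≤n⇒m≤1+n (perm-entries≤ σ↭))

<ᵇ-true : ∀ {m n} → m < n → (m <ᵇ n) ≡ true
<ᵇ-true {m} {n} m<n = det (ℕ.<ᵇ-reflects-< m n) (ofʸ m<n)

<ᵇ-false : ∀ {m n} → ¬ m < n → (m <ᵇ n) ≡ false
<ᵇ-false {m} {n} m≮n = det (ℕ.<ᵇ-reflects-< m n) (ofⁿ m≮n)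

≤ᵇ-true : ∀ {m n} → m ≤ n → (m ≤ᵇ n) ≡ true
≤ᵇ-true {m} {n} m≤n = det (ℕ.≤ᵇ-reflects-≤ m n) (ofʸ m≤n)

≤ᵇ-false : ∀ {m n} → ¬ m ≤ n → (m ≤ᵇ n) ≡ false
≤ᵇ-false {m} {n} m≰n = det (ℕ.≤ᵇ-reflects-≤ m n) (ofⁿ m≰n)

≡ᵇ-reflects-≡ : ∀ m n → Reflects (m ≡ n) (m ≡ᵇ n)
≡ᵇ-reflects-≡ m n = fromEquivalence (ℕ.≡ᵇ⇒≡ m n) (ℕ.≡⇒≡ᵇ m n)

≡ᵇ-true : ∀ {m n} → m ≡ n → (m ≡ᵇ n) ≡ true
≡ᵇ-true {m} {n} m≡n = det (≡ᵇ-reflects-≡ m n) (ofʸ m≡n)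

≡ᵇ-false : ∀ {m n} → m ≢ n → (m ≡ᵇ n) ≡ false
≡ᵇ-false {m} {n} m≢n = det (≡ᵇ-reflects-≡ m n) (ofⁿ m≢n)

∸-<ᵇ-swap : ∀ {N a b} → b ≤ N → (N ∸ b <ᵇ N ∸ a) ≡ (a <ᵇ b)
∸-<ᵇ-swap {N} {a} {b} b≤N = det (ℕ.<ᵇ-reflects-< (N ∸ b) (N ∸ a))
  (fromEquivalence (λ t → ℕ.∸-monoʳ-< (ℕ.<ᵇ⇒< a b t) b≤N) (ℕ.<⇒<ᵇ ∘ ℕ.∸-cancelʳ-< {b} {a} {N}))

<ᵇ-flip : ∀ {a b} → a ≢ b → (b <ᵇ a) ≡ not (a <ᵇ b)
<ᵇ-flip {a} {b} a≢b with ℕ.<-cmp a b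
... | tri< a<b _ b≮a rewrite <ᵇ-true a<b | <ᵇ-false b≮a = refl
... | tri≈ _ a≡b _   = ⊥-elim (a≢b a≡b)
... | tri> a≮b _ b<a rewrite <ᵇ-true b<a | <ᵇ-false a≮b = refl

∸-≡ᵇ-swap : ∀ {N a b} → a ≤ N → b ≤ N → (N ∸ a ≡ᵇ b) ≡ (a ≡ᵇ N ∸ b)
∸-≡ᵇ-swap {N} {a} {b} a≤N b≤N = det (≡ᵇ-reflects-≡ (N ∸ a) b) (fromEquivalence
  (λ t → trans (cong (N ∸_) (ℕ.≡ᵇ⇒≡ a (N ∸ b) t)) (ℕ.m∸[m∸n]≡n b≤N))
  (λ N∸a≡b → ℕ.≡⇒≡ᵇ a (N ∸ b) (trans (sym (ℕ.m∸[m∸n]≡n a≤N)) (cong (N ∸_) N∸a≡b))))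

∸-≡ᵇ-cancel : ∀ {N a b} → a ≤ N → b ≤ N → (N ∸ a ≡ᵇ N ∸ b) ≡ (b ≡ᵇ a)
∸-≡ᵇ-cancel {N} {a} {b} a≤N b≤N = det (≡ᵇ-reflects-≡ (N ∸ a) (N ∸ b)) (fromEquivalence
  (λ t → cong (N ∸_) (sym (ℕ.≡ᵇ⇒≡ b a t)))
  (λ N∸a≡N∸b → ℕ.≡⇒≡ᵇ b a (sym (ℕ.∸-cancelˡ-≡ a≤N b≤N N∸a≡N∸b))))

complement-<ᵇ : ∀ {N a b} → b ≤ N → a ≢ b → (N ∸ b <ᵇ N ∸ a) ≡ not (b <ᵇ a)
complement-<ᵇ b≤N a≢b = trans (∸-<ᵇ-swap b≤N) (<ᵇ-flip (a≢b ∘ sym))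

+-pairwise : ∀ a b c d {m k} → a + c ≡ m → b + d ≡ k → (a + b) + (c + d) ≡ m + k
+-pairwise a b c d a+c≡m b+d≡k = trans (interchange a b c d) (cong₂ _+_ a+c≡m b+d≡k)

ExactlyOne : Set → Set → Set
ExactlyOne P Q = (P → ¬ Q) × (¬ P → Q)

length-filter-complementary : ∀ {A B : Set} {P : A → Set} {Q : B → Set}
  (P? : Decidable P) (Q? : Decidable Q) (g : A → B) xs →
  All (λ x → ExactlyOne (P x) (Q (g x))) xs →
  length (filter P? xs) + length (filter Q? (map g xs)) ≡ length xs
length-filter-complementary P? Q? g []       []                  = refl
length-filter-complementary P? Q? g (x ∷ xs) ((P⇒¬Q , ¬P⇒Q) ∷ h) with P? x | Q? (g x)
... | yes p | yes q = ⊥-elim (P⇒¬Q p q)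
... | yes _ | no _  = cong suc (length-filter-complementary P? Q? g xs h)
... | no _  | yes _ = trans (ℕ.+-suc _ _) (cong suc (length-filter-complementary P? Q? g xs h))
... | no p  | no q  = ⊥-elim (q (¬P⇒Q p))

countLess-complement : ∀ {N a xs} → All (_≤ N) xs → All (a ≢_) xs →
  countLess a xs + countLess (N ∸ a) (map (N ∸_) xs) ≡ length xs
countLess-complement {N} {a} {xs} xs≤N a∉xs =
  length-filter-complementary (ℕ._<? a) (ℕ._<? N ∸ a) (N ∸_) xs (All.zipWith exactlyOne (xs≤N , a∉xs))
  where
  exactlyOne : ∀ {b} → b ≤ N × a ≢ b → ExactlyOne (b < a) (N ∸ b < N ∸ a)
  exactlyOne (b≤N , a≢b) =
    (λ b<a → ℕ.<-asym b<a ∘ ℕ.∸-cancelʳ-<) ,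
    (λ b≮a → ℕ.∸-monoʳ-< (ℕ.≤∧≢⇒< (ℕ.≮⇒≥ b≮a) a≢b) b≤N)

-- Inversions

[1+m]C2≡m+mC2 : ∀ m → suc m C 2 ≡ m + m C 2
[1+m]C2≡m+mC2 m = begin
  suc m C 2        ≡⟨ sym (nCk+nC[k+1]≡[n+1]C[k+1] m 1) ⟩
  m C 1 + m C 2    ≡⟨ cong (_+ m C 2) (nC1≡n m) ⟩
  m + m C 2        ∎
  where open ≡-Reasoning

inv-complement : ∀ {N} σ → Distinct≤ N σ → inv σ + inv (map (N ∸_) σ) ≡ length σ C 2
inv-complement []       _ = refl
inv-complement {N} (a ∷ xs) (_ ∷ xs≤N , a∉xs ∷ xs-unique) = begin
  (countLess a xs + inv xs) + (countLess (N ∸ a) (map (N ∸_) xs) + inv (map (N ∸_) xs))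
    ≡⟨ interchange (countLess a xs) _ _ _ ⟩
  (countLess a xs + countLess (N ∸ a) (map (N ∸_) xs)) + (inv xs + inv (map (N ∸_) xs))
    ≡⟨ cong₂ _+_ (countLess-complement xs≤N a∉xs) (inv-complement xs (xs≤N , xs-unique)) ⟩
  length xs + length xs C 2
    ≡⟨ sym ([1+m]C2≡m+mC2 (length xs)) ⟩
  suc (length xs) C 2 ∎
  where open ≡-Reasoning

headInversions : List ℕ → ℕ
headInversions []       = 0
headInversions (a ∷ xs) = countLess a xs

invOfEntry≡headInversions-drop : ∀ i σ → invOfEntry i σ ≡ headInversions (drop (i ∸ 1) σ)
invOfEntry≡headInversions-drop i σ with drop (i ∸ 1) σ
... | []    = refl
... | _ ∷ _ = refl

headInversions-complement : ∀ {N} σ → Distinct≤ N σ →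
  headInversions σ + headInversions (map (N ∸_) σ) ≡ ℕ.pred (length σ)
headInversions-complement []       _                          = refl
headInversions-complement (a ∷ xs) (_ ∷ xs≤N , a∉xs ∷ _) = countLess-complement xs≤N a∉xs

invOfEntry-complement : ∀ {N} i σ → Distinct≤ N σ →
  invOfEntry (suc i) σ + invOfEntry (suc i) (map (N ∸_) σ) ≡ length σ ∸ suc i
invOfEntry-complement {N} i σ (σ≤N , σ-unique) = begin
  invOfEntry (suc i) σ + invOfEntry (suc i) (map (N ∸_) σ)
    ≡⟨ cong₂ _+_ (invOfEntry≡headInversions-drop (suc i) σ)
                 (trans (invOfEntry≡headInversions-drop (suc i) (map (N ∸_) σ))
                        (cong headInversions (List.drop-map i σ))) ⟩
  headInversions (drop i σ) + headInversions (map (N ∸_) (drop i σ))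
    ≡⟨ headInversions-complement (drop i σ) (All.drop⁺ i σ≤N , Unique.drop⁺ i σ-unique) ⟩
  ℕ.pred (length (drop i σ))
    ≡⟨ cong ℕ.pred (List.length-drop i σ) ⟩
  ℕ.pred (length σ ∸ i)
    ≡⟨ ℕ.pred[m∸n]≡m∸[1+n] (length σ) i ⟩
  length σ ∸ suc i ∎
  where open ≡-Reasoning

-- Descents

adjacentPositions : ℕ → ℕ → List ℕ
adjacentPositions i zero          = []
adjacentPositions i (suc zero)    = []
adjacentPositions i (suc (suc m)) = i ∷ adjacentPositions (suc i) (suc m)

descentsFrom-complement : ∀ {N} i σ → Distinct≤ N σ →
  descentsFrom i σ ++ descentsFrom i (map (N ∸_) σ) ↭ adjacentPositions i (length σ)
descentsFrom-complement i []           _ = ↭-refl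
descentsFrom-complement i (a ∷ [])     _ = ↭-refl
descentsFrom-complement i (a ∷ b ∷ xs) (_ ∷ b≤N ∷ xs≤N , (a≢b ∷ _) ∷ bxs-unique)
  with ih ← descentsFrom-complement (suc i) (b ∷ xs) (b≤N ∷ xs≤N , bxs-unique)
  rewrite complement-<ᵇ {a = a} b≤N a≢b with b <ᵇ a
... | true  = prep i ih
... | false = ↭-trans (↭.shift i (descentsFrom (suc i) (b ∷ xs)) _) (prep i ih)

descents-complement : (s : List ℕ → ℕ) →
  (∀ xs ys → s (xs ++ ys) ≡ s xs + s ys) → (∀ {xs ys} → xs ↭ ys → s xs ≡ s ys) →
  ∀ {N} σ → Distinct≤ N σ →
  s (descents σ) + s (descents (map (N ∸_) σ)) ≡ s (adjacentPositions 1 (length σ))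
descents-complement s s-++ s-↭ σ σ-distinct =
  trans (sym (s-++ _ _)) (s-↭ (descentsFrom-complement 1 σ σ-distinct))

countFiltered-++ : ∀ {A : Set} {P : A → Set} (P? : Decidable P) xs ys →
  length (filter P? (xs ++ ys)) ≡ length (filter P? xs) + length (filter P? ys)
countFiltered-++ P? xs ys = trans (cong length (List.filter-++ P? xs ys)) (List.length-++ (filter P? xs))

countFiltered-↭ : ∀ {A : Set} {P : A → Set} (P? : Decidable P) {xs ys} → xs ↭ ys →
  length (filter P? xs) ≡ length (filter P? ys)
countFiltered-↭ P? = ↭.↭-length ∘ ↭.filter-↭ P?

-- The walk

nonNegStep : ℤ → ℤ → ℕ
nonNegStep h h′ = if nonNeg h ∧ nonNeg h′ then 1 else 0

reflected-down-step : ∀ h → nonNegStep h (h ℤ.- + 1) + nonNegStep (ℤ.- h) (ℤ.- h ℤ.+ + 1) ≡ 1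
reflected-down-step (+ zero)  = refl
reflected-down-step (+ suc _) = refl
reflected-down-step -[1+ _ ]  = refl

reflected-up-step : ∀ h → nonNegStep h (h ℤ.+ + 1) + nonNegStep (ℤ.- h) (ℤ.- h ℤ.- + 1) ≡ 1
reflected-up-step (+ zero)       = refl
reflected-up-step (+ suc _)      = refl
reflected-up-step -[1+ zero ]    = refl
reflected-up-step -[1+ suc _ ]   = refl

walk-complement : ∀ {N} h {h′} σ → h′ ≡ ℤ.- h → Distinct≤ N σ →
  walkCount h σ + walkCount h′ (map (N ∸_) σ) ≡ ℕ.pred (length σ)
walk-complement h []           _    _ = refl
walk-complement h (a ∷ [])     _    _ = refl
walk-complement h (a ∷ b ∷ xs) refl (_ ∷ b≤N ∷ xs≤N , (a≢b ∷ _) ∷ bxs-unique)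
  with ih ← (λ h₁ {h₂} (h₂≡-h₁ : h₂ ≡ ℤ.- h₁) →
               walk-complement h₁ (b ∷ xs) h₂≡-h₁ (b≤N ∷ xs≤N , bxs-unique))
  rewrite complement-<ᵇ {a = a} b≤N a≢b with b <ᵇ a
... | true  = +-pairwise (nonNegStep h h₁) (walkCount h₁ (b ∷ xs)) (nonNegStep (ℤ.- h) h₂) _
                (reflected-down-step h) (ih h₁ (neg-down h))
  where
  h₁ = h ℤ.- + 1
  h₂ = ℤ.- h ℤ.+ + 1
  neg-down : ∀ h → ℤ.- h ℤ.+ + 1 ≡ ℤ.- (h ℤ.- + 1)
  neg-down = solve-∀
... | false = +-pairwise (nonNegStep h h₁) (walkCount h₁ (b ∷ xs)) (nonNegStep (ℤ.- h) h₂) _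
                (reflected-up-step h) (ih h₁ (neg-up h))
  where
  h₁ = h ℤ.+ + 1
  h₂ = ℤ.- h ℤ.- + 1
  neg-up : ∀ h → ℤ.- h ℤ.- + 1 ≡ ℤ.- (h ℤ.+ + 1)
  neg-up = solve-∀

-- Vincular patterns

T-exactlyOne-not : ∀ p → ExactlyOne (T p) (T (not p))
T-exactlyOne-not true  = (λ _ ()) , λ ¬t → ⊥-elim (¬t _)
T-exactlyOne-not false = (λ ()) , _

patB-complement : ∀ {N a b c} → a ≤ N → b ≤ N → c ≤ N → a ≢ b → a ≢ c → b ≢ c →
  patB (N ∸ a) (N ∸ b) (N ∸ c) ≡ not (patB a b c)
patB-complement {N} {a} {b} {c} a≤N b≤N c≤N a≢b a≢c b≢c
  rewrite ∸-<ᵇ-swap {N} {c} {a} a≤N | ∸-<ᵇ-swap {N} {b} {c} c≤N | ∸-<ᵇ-swap {N} {a} {b} b≤N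
        | <ᵇ-flip a≢b | <ᵇ-flip a≢c | <ᵇ-flip b≢c
  = truthTable (a <ᵇ b) (a <ᵇ c) (b <ᵇ c)
  where
  truthTable : ∀ p q r →
    ((not q ∧ r) ∨ (p ∧ not q) ∨ (r ∧ p)) ≡ not ((q ∧ not r) ∨ (not p ∧ q) ∨ (not r ∧ not p))
  truthTable true  true  true  = refl
  truthTable true  true  false = refl
  truthTable true  false true  = refl
  truthTable true  false false = refl
  truthTable false true  true  = refl
  truthTable false true  false = refl
  truthTable false false true  = refl
  truthTable false false false = refl

vincOcc-complement : ∀ {N} σ → Distinct≤ N σ → vincOcc σ + vincOcc (map (N ∸_) σ) ≡ ℕ.pred (length σ) C 2
vincOcc-complement []           _ = refl
vincOcc-complement (a ∷ [])     _ = refl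
vincOcc-complement {N} (a ∷ b ∷ xs) (a≤N ∷ b≤N ∷ xs≤N , (a≢b ∷ a∉xs) ∷ b∉xs ∷ xs-unique) =
  trans (interchange (length (filter (T? ∘ patB a b) xs)) _ _ _)
    (trans (cong₂ _+_ (length-filter-complementary (T? ∘ patB a b) _ (N ∸_) xs occurrences-complementary)
                      (vincOcc-complement (b ∷ xs) (b≤N ∷ xs≤N , b∉xs ∷ xs-unique)))
           (sym ([1+m]C2≡m+mC2 (length xs))))
  where
  occurrences-complementary : All (λ c → ExactlyOne (T (patB a b c)) (T (patB (N ∸ a) (N ∸ b) (N ∸ c)))) xs
  occurrences-complementary = All.zipWith (λ { (c≤N , (a≢c , b≢c)) →
    subst (ExactlyOne _ ∘ T) (sym (patB-complement a≤N b≤N c≤N a≢b a≢c b≢c)) (T-exactlyOne-not _) })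
    (xs≤N , All.zip (a∉xs , b∉xs))

-- Staircase size

greedy : ℕ → List ℕ → ℕ
greedy j []       = 0
greedy j (y ∷ ys) = if j ≤ᵇ y then suc (greedy (suc j) ys) else greedy j ys

greedy-suc-bounds : ∀ j ys → greedy (suc j) ys ≤ greedy j ys × greedy j ys ≤ suc (greedy (suc j) ys)
greedy-suc-bounds j []       = z≤n , z≤n
greedy-suc-bounds j (y ∷ ys) with suc j ℕ.≤? y | j ℕ.≤? y
... | yes j<y | _       rewrite ≤ᵇ-true j<y | ≤ᵇ-true (ℕ.<⇒≤ j<y) =
  s≤s (proj₁ (greedy-suc-bounds (suc j) ys)) , s≤s (proj₂ (greedy-suc-bounds (suc j) ys))
... | no j≮y  | yes j≤y rewrite ≤ᵇ-false j≮y | ≤ᵇ-true j≤y = ℕ.n≤1+n _ , ℕ.≤-refl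
... | no j≮y  | no j≰y  rewrite ≤ᵇ-false j≮y | ≤ᵇ-false j≰y = greedy-suc-bounds j ys

greedy≤length : ∀ j ys → greedy j ys ≤ length ys
greedy≤length j []       = z≤n
greedy≤length j (y ∷ ys) with j ≤ᵇ y
... | true  = s≤s (greedy≤length (suc j) ys)
... | false = ℕ.m≤n⇒m≤1+n (greedy≤length j ys)

<ᵇ-∨-absorb : ∀ k {m m′} → m ≤ m′ → ((k <ᵇ m′) ∨ (k <ᵇ m)) ≡ (k <ᵇ m′)
<ᵇ-∨-absorb k {m} {m′} m≤m′ with k ℕ.<? m′
... | yes k<m′ rewrite <ᵇ-true k<m′ = refl
... | no  k≮m′ rewrite <ᵇ-false k≮m′ | <ᵇ-false {k} {m} (λ k<m → k≮m′ (ℕ.<-≤-trans k<m m≤m′)) = refl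

canPick≡greedy : ∀ j k ys → canPick j k ys ≡ (k <ᵇ j + greedy j ys)
canPick≡greedy j k ys with k <ᵇ j in k<j
canPick≡greedy j k ys       | true  =
  sym (<ᵇ-true (ℕ.≤-trans (ℕ.<ᵇ⇒< k j (subst T (sym k<j) _)) (ℕ.m≤m+n j _)))
canPick≡greedy j k []       | false = sym (trans (cong (k <ᵇ_) (ℕ.+-identityʳ j)) k<j)
canPick≡greedy j k (y ∷ ys) | false
  rewrite canPick≡greedy (suc j) k ys | canPick≡greedy j k ys with j ≤ᵇ y
... | true  = trans (cong (λ n → (k <ᵇ n) ∨ (k <ᵇ j + greedy j ys)) (sym (ℕ.+-suc j _)))
                    (<ᵇ-∨-absorb k (ℕ.+-monoʳ-≤ j (proj₂ (greedy-suc-bounds j ys))))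
... | false = refl

maxStair≡greedy : ∀ σ m → greedy 1 (reverse (lehmer σ)) ≤ m → maxStair σ m ≡ greedy 1 (reverse (lehmer σ))
maxStair≡greedy σ zero    g≤0 = sym (ℕ.n≤0⇒n≡0 g≤0)
maxStair≡greedy σ (suc m) g≤1+m rewrite canPick≡greedy 1 (suc m) (reverse (lehmer σ))
  with suc m ℕ.≤? greedy 1 (reverse (lehmer σ))
... | yes m<g rewrite <ᵇ-true m<g = ℕ.≤-antisym m<g g≤1+m
... | no  m≮g rewrite <ᵇ-false m≮g = maxStair≡greedy σ m (ℕ.≮⇒≥ m≮g)

length-lehmer : ∀ σ → length (lehmer σ) ≡ length σ
length-lehmer []      = refl
length-lehmer (a ∷ σ) = cong suc (length-lehmer σ)

staircase≡greedy : ∀ σ → staircase σ ≡ greedy 1 (reverse (lehmer σ))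
staircase≡greedy σ = maxStair≡greedy σ (length σ)
  (ℕ.≤-trans (greedy≤length 1 (reverse (lehmer σ)))
             (ℕ.≤-reflexive (trans (List.length-reverse (lehmer σ)) (length-lehmer σ))))

data SumsFrom : ℕ → List ℕ → List ℕ → Set where
  []  : ∀ {m} → SumsFrom m [] []
  _∷_ : ∀ {m y z ys zs} → y + z ≡ m → SumsFrom (suc m) ys zs → SumsFrom m (y ∷ ys) (z ∷ zs)

-- Exactly one of the two greedy scans picks each entry, since the thresholds also add up to m + 1.
greedy-complementary : ∀ {m ys zs} → SumsFrom m ys zs → ∀ j j′ → j + j′ ≡ suc m →
  greedy j ys + greedy j′ zs ≡ length ys
greedy-complementary []                         j j′ _ = refl
greedy-complementary {m} {y ∷ _} {z ∷ _} (y+z≡m ∷ rest) j j′ j+j′≡1+m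
  with j ℕ.≤? y | j′ ℕ.≤? z
... | yes j≤y | yes j′≤z = ⊥-elim (ℕ.n≮n m (begin-strict
  m         <⟨ ℕ.n<1+n m ⟩
  suc m     ≡⟨ sym j+j′≡1+m ⟩
  j + j′    ≤⟨ ℕ.+-mono-≤ j≤y j′≤z ⟩
  y + z     ≡⟨ y+z≡m ⟩
  m         ∎))
  where open ℕ.≤-Reasoning
... | yes j≤y | no j′≰z rewrite ≤ᵇ-true j≤y | ≤ᵇ-false j′≰z =
  cong suc (greedy-complementary rest (suc j) j′ (cong suc j+j′≡1+m))
... | no j≰y | yes j′≤z rewrite ≤ᵇ-false j≰y | ≤ᵇ-true j′≤z =
  trans (ℕ.+-suc _ _) (cong suc (greedy-complementary rest j (suc j′) (trans (ℕ.+-suc j j′) (cong suc j+j′≡1+m))))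
... | no j≰y | no j′≰z = ⊥-elim (ℕ.n≮n (suc m) (begin-strict
  suc m         <⟨ ℕ.n<1+n (suc m) ⟩
  suc (suc m)   ≡⟨ cong (suc ∘ suc) (sym y+z≡m) ⟩
  suc (suc (y + z)) ≡⟨ cong suc (sym (ℕ.+-suc y z)) ⟩
  suc y + suc z ≤⟨ ℕ.+-mono-≤ (ℕ.≰⇒> j≰y) (ℕ.≰⇒> j′≰z) ⟩
  j + j′        ≡⟨ j+j′≡1+m ⟩
  suc m         ∎))
  where open ℕ.≤-Reasoning

greedy-complementary-from-0 : ∀ {ys zs} → SumsFrom 0 ys zs → greedy 1 ys + greedy 1 zs ≡ ℕ.pred (length ys)
greedy-complementary-from-0 []                      = refl
greedy-complementary-from-0 {y ∷ _} (y+z≡0 ∷ rest)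
  rewrite ℕ.m+n≡0⇒m≡0 y y+z≡0 | ℕ.m+n≡0⇒n≡0 y y+z≡0 = greedy-complementary rest 1 1 refl

data SumsToTailLength : List ℕ → List ℕ → Set where
  []  : SumsToTailLength [] []
  _∷_ : ∀ {y z ys zs} → y + z ≡ length ys → SumsToTailLength ys zs → SumsToTailLength (y ∷ ys) (z ∷ zs)

lehmer-complement : ∀ {N} σ → Distinct≤ N σ → SumsToTailLength (lehmer σ) (lehmer (map (N ∸_) σ))
lehmer-complement []       _                               = []
lehmer-complement (a ∷ xs) (_ ∷ xs≤N , a∉xs ∷ xs-unique) =
  trans (countLess-complement xs≤N a∉xs) (sym (length-lehmer xs)) ∷ lehmer-complement xs (xs≤N , xs-unique)

SumsFrom-∷ʳ : ∀ {m xs ws y z} → SumsFrom m xs ws → y + z ≡ m + length xs →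
  SumsFrom m (xs ∷ʳ y) (ws ∷ʳ z)
SumsFrom-∷ʳ {m} []                       y+z≡m   = trans y+z≡m (ℕ.+-identityʳ m) ∷ []
SumsFrom-∷ʳ {m} {_ ∷ xs} (x+w≡m ∷ rest) y+z≡m+ =
  x+w≡m ∷ SumsFrom-∷ʳ rest (trans y+z≡m+ (ℕ.+-suc m (length xs)))

reverse-SumsToTailLength : ∀ {ys zs} → SumsToTailLength ys zs → SumsFrom 0 (reverse ys) (reverse zs)
reverse-SumsToTailLength []                     = []
reverse-SumsToTailLength {y ∷ ys} {z ∷ zs} (y+z≡ℓ ∷ rest) =
  subst₂ (SumsFrom 0) (sym (List.unfold-reverse y ys)) (sym (List.unfold-reverse z zs))
    (SumsFrom-∷ʳ (reverse-SumsToTailLength rest) (trans y+z≡ℓ (sym (List.length-reverse ys))))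

staircase-complement : ∀ {N} σ → Distinct≤ N σ →
  staircase σ + staircase (map (N ∸_) σ) ≡ ℕ.pred (length σ)
staircase-complement {N} σ σ-distinct = begin
  staircase σ + staircase (map (N ∸_) σ)
    ≡⟨ cong₂ _+_ (staircase≡greedy σ) (staircase≡greedy (map (N ∸_) σ)) ⟩
  greedy 1 (reverse (lehmer σ)) + greedy 1 (reverse (lehmer (map (N ∸_) σ)))
    ≡⟨ greedy-complementary-from-0 (reverse-SumsToTailLength (lehmer-complement σ σ-distinct)) ⟩
  ℕ.pred (length (reverse (lehmer σ)))
    ≡⟨ cong ℕ.pred (trans (List.length-reverse (lehmer σ)) (length-lehmer σ)) ⟩
  ℕ.pred (length σ) ∎
  where open ≡-Reasoning

-- Lexicographic rank

count : {A : Set} → (A → Bool) → List A → ℕ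
count p = length ∘ filter (T? ∘ p)

count-map : ∀ {A B : Set} (p : B → Bool) (f : A → B) xs → count p (map f xs) ≡ count (p ∘ f) xs
count-map p f []       = refl
count-map p f (x ∷ xs) with p (f x)
... | true  = cong suc (count-map p f xs)
... | false = count-map p f xs

count-cong : ∀ {A : Set} {p q : A → Bool} {xs} → All (λ x → p x ≡ q x) xs → count p xs ≡ count q xs
count-cong {xs = []}     []               = refl
count-cong {p = p} {q} {x ∷ xs} (px≡qx ∷ rest) with p x | q x | px≡qx
... | true  | true  | refl = cong suc (count-cong rest)
... | false | false | refl = count-cong rest

count-filter : ∀ {A : Set} (p q : A → Bool) xs → count q (filter (T? ∘ p) xs) ≡ count (λ x → p x ∧ q x) xs
count-filter p q []       = refl
count-filter p q (x ∷ xs) with p x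
... | false = count-filter p q xs
... | true with q x
...   | true  = cong suc (count-filter p q xs)
...   | false = count-filter p q xs

count-++ : ∀ {A : Set} (p : A → Bool) xs ys → count p (xs ++ ys) ≡ count p xs + count p ys
count-++ p xs ys = countFiltered-++ (T? ∘ p) xs ys

count-concatMap : ∀ {A B : Set} (p : B → Bool) (g : A → List B) xs →
  count p (concatMap g xs) ≡ sum (map (count p ∘ g) xs)
count-concatMap p g []       = refl
count-concatMap p g (x ∷ xs) = trans (count-++ p (g x) _) (cong (λ m → count p (g x) + m) (count-concatMap p g xs))

count-false : ∀ {A : Set} (xs : List A) → count (λ _ → false) xs ≡ 0
count-false []       = refl
count-false (_ ∷ xs) = count-false xs

toℕ : Bool → ℕ
toℕ true  = 1
toℕ false = 0

count-trichotomy : ∀ {A : Set} (p q r : A → Bool) xs → All (λ x → toℕ (p x) + toℕ (q x) + toℕ (r x) ≡ 1) xs →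
  count p xs + count q xs + count r xs ≡ length xs
count-trichotomy p q r []       []             = refl
count-trichotomy p q r (x ∷ xs) (exactlyOne ∷ rest) with p x | q x | r x | exactlyOne
... | true  | false | false | _ = cong suc (count-trichotomy p q r xs rest)
... | false | true  | false | _ =
  trans (cong (_+ count r xs) (ℕ.+-suc (count p xs) _)) (cong suc (count-trichotomy p q r xs rest))
... | false | false | true  | _ = trans (ℕ.+-suc _ (count r xs)) (cong suc (count-trichotomy p q r xs rest))
... | true  | true  | _     | ()
... | true  | false | true  | ()
... | false | true  | true  | ()
... | false | false | false | ()

listEqᵇ : List ℕ → List ℕ → Bool
listEqᵇ []       []       = true
listEqᵇ []       (_ ∷ _)  = false
listEqᵇ (_ ∷ _)  []       = false
listEqᵇ (a ∷ xs) (b ∷ ys) = (a ≡ᵇ b) ∧ listEqᵇ xs ys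

listEqᵇ⇒≡ : ∀ xs ys → T (listEqᵇ xs ys) → xs ≡ ys
listEqᵇ⇒≡ []       []       _ = refl
listEqᵇ⇒≡ (a ∷ xs) (b ∷ ys) t with a ≡ᵇ b in a≡ᵇb
... | true = cong₂ _∷_ (ℕ.≡ᵇ⇒≡ a b (subst T (sym a≡ᵇb) _)) (listEqᵇ⇒≡ xs ys t)

lex-trichotomy : ∀ xs ys → length xs ≡ length ys →
  toℕ (lexLtB xs ys) + toℕ (lexLtB ys xs) + toℕ (listEqᵇ xs ys) ≡ 1
lex-trichotomy []       []       _ = refl
lex-trichotomy (a ∷ xs) (b ∷ ys) same-length with ℕ.<-cmp a b
... | tri< a<b a≢b b≮a rewrite <ᵇ-true a<b | <ᵇ-false b≮a | ≡ᵇ-false a≢b | ≡ᵇ-false (a≢b ∘ sym) = refl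
... | tri≈ a≮b refl _  rewrite <ᵇ-false a≮b | ≡ᵇ-true (refl {x = a}) =
  lex-trichotomy xs ys (ℕ.suc-injective same-length)
... | tri> a≮b a≢b b<a rewrite <ᵇ-true b<a | <ᵇ-false a≮b | ≡ᵇ-false a≢b = refl

lexLtB-complement : ∀ {N} xs ys → length xs ≡ length ys → All (_≤ N) xs → All (_≤ N) ys →
  lexLtB (map (N ∸_) xs) (map (N ∸_) ys) ≡ lexLtB ys xs
lexLtB-complement []       []       _           _           _           = refl
lexLtB-complement (a ∷ xs) (b ∷ ys) same-length (a≤N ∷ xs≤N) (b≤N ∷ ys≤N) =
  cong₂ _∨_ (∸-<ᵇ-swap a≤N)
    (cong₂ _∧_ (∸-≡ᵇ-cancel a≤N b≤N)
               (lexLtB-complement xs ys (ℕ.suc-injective same-length) xs≤N ys≤N))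

Word : ℕ → ℕ → List ℕ → Set
Word n k τ = length τ ≡ k × All (_∈ oneTo n) τ

words-Word : ∀ n k → All (Word n k) (words n k)
words-Word n zero    = (refl , []) ∷ []
words-Word n (suc k) = All.concat⁺ (All.map⁺ (All.tabulate λ a∈ →
  All.map⁺ (All.map (λ { (ℓ≡k , τ∈) → cong suc ℓ≡k , a∈ ∷ τ∈ }) (words-Word n k))))

Word⇒entries≤ : ∀ {n k τ} → Word n k τ → All (_≤ suc n) τ
Word⇒entries≤ {n} (_ , τ∈) = All.map (ℕ.m≤n⇒m≤1+n ∘ ∈-oneTo⇒≤ n) τ∈

oneTo-complement : ∀ n → map (suc n ∸_) (oneTo n) ↭ oneTo n
oneTo-complement n = ↭-trans (↭-reflexive complement≡reverse) (↭.↭-reverse (oneTo n))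
  where
  open Data.List using (upTo; downFrom; applyUpTo; applyDownFrom)
  open ≡-Reasoning
  countdown : ∀ n → applyUpTo (n ∸_) n ≡ applyDownFrom suc n
  countdown zero    = refl
  countdown (suc n) = cong (suc n ∷_) (countdown n)
  complement≡reverse : map (suc n ∸_) (oneTo n) ≡ reverse (oneTo n)
  complement≡reverse = begin
    map (suc n ∸_) (map suc (upTo n))  ≡⟨ cong (map (suc n ∸_)) (List.map-applyUpTo (λ i → i) suc n) ⟩
    map (suc n ∸_) (applyUpTo suc n)   ≡⟨ List.map-applyUpTo suc (suc n ∸_) n ⟩
    applyUpTo (n ∸_) n                 ≡⟨ countdown n ⟩
    applyDownFrom suc n                ≡⟨ sym (List.map-applyDownFrom (λ i → i) suc n) ⟩
    map suc (downFrom n)               ≡⟨ cong (map suc) (sym (List.reverse-upTo n)) ⟩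
    map suc (reverse (upTo n))         ≡⟨ List.reverse-map suc (upTo n) ⟩
    reverse (map suc (upTo n))         ∎

sum-oneTo-complement : ∀ n (F : ℕ → ℕ) → sum (map F (oneTo n)) ≡ sum (map (F ∘ (suc n ∸_)) (oneTo n))
sum-oneTo-complement n F =
  trans (sum-↭ (↭.map⁺ F (↭-sym (oneTo-complement n)))) (cong sum (sym (List.map-∘ (oneTo n))))

count-words-complement : ∀ n k (p : List ℕ → Bool) → count p (words n k) ≡ count (p ∘ map (suc n ∸_)) (words n k)
count-words-complement n zero    p with p []
... | true  = refl
... | false = refl
count-words-complement n (suc k) p = begin
  count p (concatMap (λ a → map (a ∷_) W) (oneTo n))
    ≡⟨ count-concatMap p _ (oneTo n) ⟩
  sum (map (λ a → count p (map (a ∷_) W)) (oneTo n))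
    ≡⟨ cong sum (List.map-cong (λ a → trans (count-map p (a ∷_) W) (count-words-complement n k (p ∘ (a ∷_))))
                               (oneTo n)) ⟩
  sum (map (λ a → count (λ τ → p (a ∷ map c τ)) W) (oneTo n))
    ≡⟨ sum-oneTo-complement n (λ a → count (λ τ → p (a ∷ map c τ)) W) ⟩
  sum (map (λ a → count (λ τ → p (c a ∷ map c τ)) W) (oneTo n))
    ≡⟨ cong sum (List.map-cong (λ a → sym (count-map (p ∘ map c) (a ∷_) W)) (oneTo n)) ⟩
  sum (map (λ a → count (p ∘ map c) (map (a ∷_) W)) (oneTo n))
    ≡⟨ count-concatMap (p ∘ map c) _ (oneTo n) ⟨
  count (p ∘ map c) (concatMap (λ a → map (a ∷_) W) (oneTo n)) ∎
  where
  open ≡-Reasoning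
  W = words n k
  c = suc n ∸_

allB⇒All : ∀ {A : Set} (p : A → Bool) xs → T (allB p xs) → All (T ∘ p) xs
allB⇒All p []       _ = []
allB⇒All p (x ∷ xs) t with p x in px
... | true = subst T (sym px) _ ∷ allB⇒All p xs t

All⇒allB : ∀ {A : Set} (p : A → Bool) xs → All (T ∘ p) xs → T (allB p xs)
All⇒allB p []       []         = _
All⇒allB p (x ∷ xs) (px ∷ pxs) with p x
... | true = All⇒allB p xs pxs

allB-↭ : ∀ {A : Set} (p : A → Bool) {xs ys} → xs ↭ ys → allB p xs ≡ allB p ys
allB-↭ p {xs} {ys} xs↭ys = det (fromEquivalence (allB⇒All p xs) (All⇒allB p xs))
  (fromEquivalence (↭.All-resp-↭ (↭-sym xs↭ys) ∘ allB⇒All p ys) (All⇒allB p ys ∘ ↭.All-resp-↭ xs↭ys))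

allB-map : ∀ {A B : Set} (p : B → Bool) (f : A → B) xs → allB p (map f xs) ≡ allB (p ∘ f) xs
allB-map p f []       = refl
allB-map p f (x ∷ xs) = cong (p (f x) ∧_) (allB-map p f xs)

allB-cong : ∀ {A : Set} {p q : A → Bool} {xs} → All (λ x → p x ≡ q x) xs → allB p xs ≡ allB q xs
allB-cong []               = refl
allB-cong (px≡qx ∷ rest) = cong₂ _∧_ px≡qx (allB-cong rest)

memberB-complement : ∀ {N i} τ → i ≤ N → All (_≤ N) τ → memberB i (map (N ∸_) τ) ≡ memberB (N ∸ i) τ
memberB-complement []      _   []           = refl
memberB-complement (a ∷ τ) i≤N (a≤N ∷ τ≤N) =
  cong₂ _∨_ (sym (∸-≡ᵇ-swap i≤N a≤N)) (memberB-complement τ i≤N τ≤N)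

∈⇒memberB : ∀ {i} σ → i ∈ σ → T (memberB i σ)
∈⇒memberB {i} (a ∷ σ) i∈ with i ≡ᵇ a in i≡ᵇa
... | true  = _
... | false with i∈
...   | here i≡a   = ⊥-elim (subst T i≡ᵇa (ℕ.≡⇒≡ᵇ i a i≡a))
...   | there i∈σ = ∈⇒memberB σ i∈σ

isPermWordB-complement : ∀ n τ → All (_∈ oneTo n) τ → isPermWordB n (map (suc n ∸_) τ) ≡ isPermWordB n τ
isPermWordB-complement n τ τ∈ = begin
  allB (λ i → memberB i (map (suc n ∸_) τ)) (oneTo n)
    ≡⟨ allB-cong (All.tabulate λ i∈ → memberB-complement τ (ℕ.m≤n⇒m≤1+n (∈-oneTo⇒≤ n i∈)) τ≤) ⟩
  allB (λ i → memberB (suc n ∸ i) τ) (oneTo n)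
    ≡⟨ allB-map (λ j → memberB j τ) (suc n ∸_) (oneTo n) ⟨
  allB (λ j → memberB j τ) (map (suc n ∸_) (oneTo n))
    ≡⟨ allB-↭ (λ j → memberB j τ) (oneTo-complement n) ⟩
  allB (λ j → memberB j τ) (oneTo n) ∎
  where
  open ≡-Reasoning
  τ≤ = Word⇒entries≤ {k = length τ} (refl , τ∈)

perm-isPermWordB : ∀ {n σ} → IsPerm n σ → isPermWordB n σ ≡ true
perm-isPermWordB {n} {σ} σ↭ = Equivalence.to T-≡
  (All⇒allB _ (oneTo n) (All.tabulate λ i∈ → ∈⇒memberB σ (↭.∈-resp-↭ (↭-sym σ↭) i∈)))

count-permsList-complement : ∀ n (p : List ℕ → Bool) → count p (permsList n) ≡ count (p ∘ compMap n) (permsList n)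
count-permsList-complement n p = begin
  count p (permsList n)
    ≡⟨ count-filter (isPermWordB n) p W ⟩
  count (λ τ → isPermWordB n τ ∧ p τ) W
    ≡⟨ count-words-complement n n (λ τ → isPermWordB n τ ∧ p τ) ⟩
  count (λ τ → isPermWordB n (compMap n τ) ∧ p (compMap n τ)) W
    ≡⟨ count-cong (All.map (λ { {τ} (_ , τ∈) → cong (_∧ p (compMap n τ)) (isPermWordB-complement n τ τ∈) })
                           (words-Word n n)) ⟩
  count (λ τ → isPermWordB n τ ∧ p (compMap n τ)) W
    ≡⟨ count-filter (isPermWordB n) (p ∘ compMap n) W ⟨
  count (p ∘ compMap n) (permsList n) ∎
  where
  open ≡-Reasoning
  W = words n n

sum-indicator-absent : ∀ {b} xs → All (_≢ b) xs → sum (map (λ a → toℕ (a ≡ᵇ b)) xs) ≡ 0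
sum-indicator-absent []       []              = refl
sum-indicator-absent (a ∷ xs) (a≢b ∷ xs≢b) rewrite ≡ᵇ-false a≢b = sum-indicator-absent xs xs≢b

sum-indicator-unique : ∀ {b} xs → Unique xs → b ∈ xs → sum (map (λ a → toℕ (a ≡ᵇ b)) xs) ≡ 1
sum-indicator-unique {b} (a ∷ xs) (a∉xs ∷ _) (here refl) rewrite ≡ᵇ-true (refl {x = b}) =
  cong suc (sum-indicator-absent xs (All.map (_∘ sym) a∉xs))
sum-indicator-unique (a ∷ xs) (a∉xs ∷ xs-unique) (there b∈xs) rewrite ≡ᵇ-false (All.lookup a∉xs b∈xs) =
  sum-indicator-unique xs xs-unique b∈xs

count-words-self : ∀ n k σ → Word n k σ → count (λ τ → listEqᵇ τ σ) (words n k) ≡ 1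
count-words-self n zero    []      _                  = refl
count-words-self n (suc k) (b ∷ σ) (ℓ≡1+k , b∈ ∷ σ∈) = begin
  count (λ τ → listEqᵇ τ (b ∷ σ)) (concatMap (λ a → map (a ∷_) W) (oneTo n))
    ≡⟨ count-concatMap _ _ (oneTo n) ⟩
  sum (map (λ a → count (λ τ → listEqᵇ τ (b ∷ σ)) (map (a ∷_) W)) (oneTo n))
    ≡⟨ cong sum (List.map-cong (λ a → trans (count-map _ (a ∷_) W) (matching-head (a ≡ᵇ b))) (oneTo n)) ⟩
  sum (map (λ a → toℕ (a ≡ᵇ b)) (oneTo n))
    ≡⟨ sum-indicator-unique (oneTo n) (oneTo-unique n) b∈ ⟩
  1 ∎
  where
  open ≡-Reasoning
  W = words n k
  matching-head : ∀ u → count (λ τ → u ∧ listEqᵇ τ σ) W ≡ toℕ u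
  matching-head true  = count-words-self n k σ (ℕ.suc-injective ℓ≡1+k , σ∈)
  matching-head false = count-false W

count-permsList-self : ∀ {n σ} → IsPerm n σ → count (λ τ → listEqᵇ τ σ) (permsList n) ≡ 1
count-permsList-self {n} {σ} σ↭ = begin
  count (λ τ → listEqᵇ τ σ) (permsList n)
    ≡⟨ count-filter (isPermWordB n) _ (words n n) ⟩
  count (λ τ → isPermWordB n τ ∧ listEqᵇ τ σ) (words n n)
    ≡⟨ count-cong (All.universal equal-is-perm (words n n)) ⟩
  count (λ τ → listEqᵇ τ σ) (words n n)
    ≡⟨ count-words-self n n σ (perm-length σ↭ , All.tabulate (↭.∈-resp-↭ σ↭)) ⟩
  1 ∎
  where
  open ≡-Reasoning
  equal-is-perm : ∀ τ → (isPermWordB n τ ∧ listEqᵇ τ σ) ≡ listEqᵇ τ σ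
  equal-is-perm τ with listEqᵇ τ σ in τ=σ
  ... | false = ∧-zeroʳ _
  ... | true  rewrite listEqᵇ⇒≡ τ σ (subst T (sym τ=σ) _) = trans (∧-identityʳ _) (perm-isPermWordB σ↭)

rank-complement : ∀ {n σ} → IsPerm n σ → rank σ + rank (compMap n σ) ≡ suc (length (permsList n))
rank-complement {n} {σ} σ↭ = begin
  rank σ + rank (compMap n σ)
    ≡⟨ cong₂ (λ m m′ → suc (count (λ τ → lexLtB τ σ) (permsList m))
                     + suc (count (λ τ → lexLtB τ (compMap n σ)) (permsList m′)))
             (perm-length σ↭) (trans (List.length-map _ σ) (perm-length σ↭)) ⟩
  suc below + suc (count (λ τ → lexLtB τ (compMap n σ)) P)
    ≡⟨ cong (λ m → suc below + suc m) (count-permsList-complement n _) ⟩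
  suc below + suc (count (λ τ → lexLtB (compMap n τ) (compMap n σ)) P)
    ≡⟨ cong (λ m → suc below + suc m) (count-cong (All.map lex-reversed (permsList-Word n))) ⟩
  suc below + suc above
    ≡⟨ cong suc (ℕ.+-suc below above) ⟩
  suc (suc (below + above))
    ≡⟨ cong suc (ℕ.+-comm 1 (below + above)) ⟩
  suc (below + above + 1)
    ≡⟨ cong (λ m → suc (below + above + m)) (count-permsList-self σ↭) ⟨
  suc (below + above + count (λ τ → listEqᵇ τ σ) P)
    ≡⟨ cong suc (count-trichotomy _ _ _ P (All.map (λ { {τ} (ℓ , _) → lex-trichotomy τ σ (same-length {τ} ℓ) })
                                                    (permsList-Word n))) ⟩
  suc (length P) ∎
  where
  open ≡-Reasoning
  P = permsList n
  below = count (λ τ → lexLtB τ σ) P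
  above = count (λ τ → lexLtB σ τ) P
  same-length : ∀ {τ} → length τ ≡ n → length τ ≡ length σ
  same-length ℓ = trans ℓ (sym (perm-length σ↭))
  permsList-Word : ∀ n → All (Word n n) (permsList n)
  permsList-Word n = All.filter⁺ _ (words-Word n n)
  lex-reversed : ∀ {τ} → Word n n τ → lexLtB (compMap n τ) (compMap n σ) ≡ lexLtB σ τ
  lex-reversed {τ} w@(ℓ , _) = lexLtB-complement τ σ (same-length {τ} ℓ) (Word⇒entries≤ w)
    (All.map ℕ.m≤n⇒m≤1+n (perm-entries≤ σ↭))

lastEntry-complement : ∀ {N} a xs → All (_≤ N) (a ∷ xs) →
  lastEntry (a ∷ xs) + lastEntry (map (N ∸_) (a ∷ xs)) ≡ N
lastEntry-complement a []       (a≤N ∷ []) = ℕ.m+[n∸m]≡n a≤N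
lastEntry-complement a (b ∷ xs) (_ ∷ rest) = lastEntry-complement b xs rest

record ComplementSum (f : List ℕ → ℤ) (K : ℕ → ℤ) : Set where
  constructor complementSum
  field
    sum≡ : ∀ n → 1 ≤ n → ∀ σ → IsPerm n σ → f σ ℤ.+ f (compMap n σ) ≡ K n

open ComplementSum

complementSum-fromDistinct : ∀ (s : List ℕ → ℕ) (F : ℕ → ℕ) →
  (∀ {N} σ → Distinct≤ N σ → s σ + s (map (N ∸_) σ) ≡ F (length σ)) →
  ComplementSum (λ σ → + s σ) (λ n → + F n)
complementSum-fromDistinct s F s-complement = complementSum λ n _ σ σ↭ →
  cong +_ (trans (s-complement σ (perm-distinct≤ σ↭)) (cong F (perm-length σ↭)))

complementSum-fromNonEmpty : ∀ (s : List ℕ → ℕ) →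
  (∀ {N} a xs → All (_≤ N) (a ∷ xs) → s (a ∷ xs) + s (map (N ∸_) (a ∷ xs)) ≡ N) →
  ComplementSum (λ σ → + s σ) (λ n → + suc n)
complementSum-fromNonEmpty s s-complement = complementSum sum≡N+1
  where
  sum≡N+1 : ∀ n → 1 ≤ n → ∀ σ → IsPerm n σ → + s σ ℤ.+ + s (compMap n σ) ≡ + suc n
  sum≡N+1 n 1≤n []       σ↭ = ⊥-elim (ℕ.<⇒≢ 1≤n (perm-length σ↭))
  sum≡N+1 n _   (a ∷ xs) σ↭ = cong +_ (s-complement a xs (proj₁ (perm-distinct≤ σ↭)))

complementSum-+ : ∀ {f g K L} → ComplementSum f K → ComplementSum g L →
  ComplementSum (λ σ → f σ ℤ.+ g σ) (λ n → K n ℤ.+ L n)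
complementSum-+ {f} {g} f-sum g-sum = complementSum λ n 1≤n σ σ↭ →
  trans (regroup (f σ) (g σ) (f (compMap n σ)) (g (compMap n σ)))
        (cong₂ ℤ._+_ (sum≡ f-sum n 1≤n σ σ↭) (sum≡ g-sum n 1≤n σ σ↭))
  where
  regroup : ∀ a b c d → (a ℤ.+ b) ℤ.+ (c ℤ.+ d) ≡ (a ℤ.+ c) ℤ.+ (b ℤ.+ d)
  regroup = solve-∀

complementSum-- : ∀ {f g K L} → ComplementSum f K → ComplementSum g L →
  ComplementSum (λ σ → f σ ℤ.- g σ) (λ n → K n ℤ.- L n)
complementSum-- {f} {g} f-sum g-sum = complementSum λ n 1≤n σ σ↭ →
  trans (regroup (f σ) (g σ) (f (compMap n σ)) (g (compMap n σ)))
        (cong₂ ℤ._-_ (sum≡ f-sum n 1≤n σ σ↭) (sum≡ g-sum n 1≤n σ σ↭))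
  where
  regroup : ∀ a b c d → (a ℤ.- b) ℤ.+ (c ℤ.- d) ≡ (a ℤ.+ c) ℤ.- (b ℤ.+ d)
  regroup = solve-∀

inv-complementSum : ComplementSum (λ σ → + inv σ) (λ n → + (n C 2))
inv-complementSum = complementSum-fromDistinct inv (_C 2) inv-complement

maj-complementSum : ComplementSum (λ σ → + maj σ) (λ n → + sum (adjacentPositions 1 n))
maj-complementSum = complementSum-fromDistinct maj (sum ∘ adjacentPositions 1) (descents-complement sum sum-++ sum-↭)

descentsCount-complementSum : ∀ {P : ℕ → Set} (P? : Decidable P) →
  ComplementSum (λ σ → + length (filter P? (descents σ))) (λ n → + length (filter P? (adjacentPositions 1 n)))
descentsCount-complementSum P? = complementSum-fromDistinct (length ∘ filter P? ∘ descents) _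
  (descents-complement (length ∘ filter P?) (countFiltered-++ P?) (countFiltered-↭ P?))

bsStat-complementSum : ComplementSum (λ σ → + bsStat σ) (λ n → + (ℕ.pred n C 2 + length (adjacentPositions 1 n)))
bsStat-complementSum =
  complementSum-fromDistinct bsStat (λ n → ℕ.pred n C 2 + length (adjacentPositions 1 n)) λ σ σ-distinct →
  +-pairwise (vincOcc σ) (length (descents σ)) _ _ (vincOcc-complement σ σ-distinct)
    (descents-complement length (λ xs _ → List.length-++ xs) ↭.↭-length σ σ-distinct)

rank-complementSum : ComplementSum (λ σ → + rank σ) (λ n → + suc (length (permsList n)))
rank-complementSum = complementSum λ _ _ _ σ↭ → cong +_ (rank-complement σ↭)

-- Counterexamples for the reverse map

NotReverseHomomesic : (List ℕ → ℤ) → Set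
NotReverseHomomesic f = Σ ℕ λ n → 1 ≤ n × ¬ Homomesic (IsPerm n) revMap f

reverseAverage : (List ℕ → ℤ) → List ℕ → ℚ
reverseAverage f σ = orbitSum f revMap σ 2 / 2

reverse-counterexample : ∀ f n {σ τ} → 1 ≤ n → IsPerm n σ → IsPerm n τ → reverse σ ≢ σ → reverse τ ≢ τ →
  reverseAverage f σ ≢ reverseAverage f τ → NotReverseHomomesic f
reverse-counterexample f n {σ} {τ} 1≤n σ↭ τ↭ σ-unpalindromic τ-unpalindromic averages≢ =
  n , 1≤n , two-orbits-not-homomesic f σ↭ τ↭ (reverse-orbit σ σ-unpalindromic) (reverse-orbit τ τ-unpalindromic)
              averages≢

counterexample-S₃ : ∀ f → reverseAverage f (1 ∷ 2 ∷ 3 ∷ []) ≢ reverseAverage f (1 ∷ 3 ∷ 2 ∷ []) →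
  NotReverseHomomesic f
counterexample-S₃ f = reverse-counterexample f 3 (s≤s z≤n) ↭-refl (prep 1 (swap 3 2 ↭-refl)) (λ ()) (λ ())

counterexample-S₄ : ∀ f → reverseAverage f (1 ∷ 2 ∷ 3 ∷ 4 ∷ []) ≢ reverseAverage f (1 ∷ 2 ∷ 4 ∷ 3 ∷ []) →
  NotReverseHomomesic f
counterexample-S₄ f = reverse-counterexample f 4 (s≤s z≤n) ↭-refl (prep 1 (prep 2 (swap 4 3 ↭-refl))) (λ ()) (λ ())

counterexample-S₅ : ∀ f → reverseAverage f (1 ∷ 2 ∷ 3 ∷ 4 ∷ 5 ∷ []) ≢ reverseAverage f (2 ∷ 1 ∷ 4 ∷ 5 ∷ 3 ∷ []) →
  NotReverseHomomesic f
counterexample-S₅ f = reverse-counterexample f 5 (s≤s z≤n) ↭-refl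
  (swap 2 1 (↭-trans (prep 4 (swap 5 3 ↭-refl)) (swap 4 3 ↭-refl))) (λ ()) (λ ())

claim : ∀ {f K} → ComplementSum f K → NotReverseHomomesic f → Claim f
claim {f} {K} f-sum counterexample =
  (λ n 1≤n → involution-homomesic f (K n) compMap-involutive (sum≡ f-sum n 1≤n _)) , counterexample

theorem5p5 : Claim (λ σ → + invOfEntry 2 σ)
    × Claim (λ σ → + invOfEntry 3 σ)
    × Claim (λ σ → + maj σ)
    × Claim (λ σ → + oddDescents σ)
    × Claim (λ σ → + evenDescents σ)
    × Claim (λ σ → + rank σ)
    × Claim (λ σ → + firstEntry σ)
    × Claim (λ σ → + staircase σ)
    × Claim (λ σ → + bsStat σ)
    × Claim (λ σ → + lastEntry σ)
    × Claim (λ σ → + nonNegSteps σ)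
    × Claim (λ σ → + maj σ ℤ.- + inv σ)
    × Claim (λ σ → + inv σ ℤ.+ + maj σ)
theorem5p5 =
    claim (complementSum-fromDistinct (invOfEntry 2) (_∸ 2) (invOfEntry-complement 1)) (counterexample-S₃ _ (λ ()))
  , claim (complementSum-fromDistinct (invOfEntry 3) (_∸ 3) (invOfEntry-complement 2)) (counterexample-S₄ _ (λ ()))
  , claim maj-complementSum (counterexample-S₃ _ (λ ()))
  , claim (descentsCount-complementSum (T? ∘ isOdd)) (counterexample-S₃ _ (λ ()))
  , claim (descentsCount-complementSum (T? ∘ not ∘ isOdd)) (counterexample-S₃ _ (λ ()))
  , claim rank-complementSum (counterexample-S₃ _ (λ ()))
  , claim (complementSum-fromNonEmpty firstEntry λ { _ _ (a≤N ∷ _) → ℕ.m+[n∸m]≡n a≤N }) (counterexample-S₃ _ (λ ()))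
  , claim (complementSum-fromDistinct staircase ℕ.pred staircase-complement) (counterexample-S₅ _ (λ ()))
  , claim bsStat-complementSum (counterexample-S₄ _ (λ ()))
  , claim (complementSum-fromNonEmpty lastEntry lastEntry-complement) (counterexample-S₃ _ (λ ()))
  , claim (complementSum-fromDistinct nonNegSteps ℕ.pred λ σ → walk-complement (+ 0) σ refl) (counterexample-S₃ _ (λ ()))
  , claim (complementSum-- maj-complementSum inv-complementSum) (counterexample-S₃ _ (λ ()))
  , claim (complementSum-+ inv-complementSum maj-complementSum) (counterexample-S₃ _ (λ ()))
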